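{- Let $n\ge3$, $\lambda\in\mathbb{Z}_{\ge0}^n$, and let $x=(x_1,\dots,x_n)\neq(1,\dots,1)$ be a positive integer solution of \[ \sum_{i=1}^n X_i^2+\sum_{i=1}^n \lambda_i\, X_1\cdots\widehat{X_i}\cdots X_n=\Big(n+\sum_{i=1}^n\lambda_i\Big)\prod_{i=1}^n X_i . \] If $x_j$ is a largest coordinate of $x$ (i.e. $x_j\ge x_i$ for all $i$), then every entry of $\mu_j(x)$ is strictly smaller than $x_j$: $(\mu_j(x))_i<x_j$ for all $i\in\{1,\dots,n\}$.
   Context: $\widehat{X_i}$ denotes an omitted factor. The mutation $\mu_j$ replaces $x_j$ by $x_j'=\big(\sum_{i\ne j}x_i^2+\lambda_j\prod_{i\ne j}x_i\big)/x_j$ and leaves all other coordinates unchanged. -}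

module Defs where

open import Data.Nat using (ℕ; zero; suc; _+_; _*_; _/_; NonZero; _≤_; _<_)
open import Data.Fin using (Fin; zero; suc)
open import Data.Bool using (Bool; true; false; if_then_else_)
open import Data.Fin.Properties using (_≟_)
open import Relation.Nullary.Decidable using (⌊_⌋)
open import Relation.Binary.PropositionalEquality using (_≡_; _≢_)
open import Data.Product using (Σ; _×_)

sumF : (n : ℕ) → (Fin n → ℕ) → ℕ
sumF zero    f = 0
sumF (suc n) f = f zero + sumF n (λ i → f (suc i))

prodF : (n : ℕ) → (Fin n → ℕ) → ℕ
prodF zero    f = 1
prodF (suc n) f = f zero * prodF n (λ i → f (suc i))

prodExcept : {n : ℕ} → Fin n → (Fin n → ℕ) → ℕ
prodExcept {n} j x = prodF n (λ i → if ⌊ i ≟ j ⌋ then 1 else x i)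

sumSqExcept : {n : ℕ} → Fin n → (Fin n → ℕ) → ℕ
sumSqExcept {n} j x = sumF n (λ i → if ⌊ i ≟ j ⌋ then 0 else x i * x i)

IsSolution : (n : ℕ) → (lam : Fin n → ℕ) → (x : Fin n → ℕ) → Set
IsSolution n lam x =
  sumF n (λ i → x i * x i) + sumF n (λ i → lam i * prodExcept i x)
    ≡ (n + sumF n lam) * prodF n x

mutate : {n : ℕ} → (lam : Fin n → ℕ) → (j : Fin n) → (x : Fin n → ℕ) →
         .{{NonZero (x j)}} → Fin n → ℕ
mutate lam j x i =
  if ⌊ i ≟ j ⌋
  then (sumSqExcept j x + lam j * prodExcept j x) / x j
  else x i

-- Write m = x_j, Q = ∏_{i≠j} x_i, S = Σ_{i≠j} x_i² and C = S + λ_j Q, so that μ_j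
-- replaces m by C / m; everything follows from C < m², which also gives
-- x_i² ≤ S < m² for i ≠ j.  Bounding the mixed terms of the equation shows
-- f m ≥ 0 for f X = X² − (n + λ_j) Q X + C.  All x_i with i ≠ j, and 1, are at most
-- t = min m Q, so S + 1 ≤ t (n − 1 + Q), which gives f t < 0 when n ≥ 3 and Q ≥ 2.
-- As t ≤ m, m then lies beyond the larger root of f, and that root exceeds √C
-- because the two roots multiply to C.  If Q = 1 one still has f 1 ≤ 0, so
-- f X ≤ (X − 1) (X − C), and f m ≥ 0 with m ≥ 2 forces C ≤ m < m².
module Submission where

open import Defs
open import Data.Nat using (ℕ; zero; suc; _+_; _*_; _≤_; _<_; _⊓_; z≤n; s≤s; s≤s⁻¹; _≤?_; >-nonZero)
open import Data.Nat.Properties hiding (_≟_)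
open import Data.Nat.DivMod using (m<n*o⇒m/o<n)
open import Data.Nat.Tactic.RingSolver using (solve-∀)
open import Data.Fin using (Fin; zero; suc)
open import Data.Fin.Properties using (_≟_)
open import Function using (_∘_)
open import Data.Bool using (true; false; if_then_else_)
open import Data.Product using (_,_)
open import Relation.Nullary using (¬_; yes; no; contradiction)
open import Relation.Nullary.Decidable using (⌊_⌋)
open import Relation.Binary.PropositionalEquality
  using (_≡_; _≢_; refl; sym; cong; cong₂; subst; subst₂; module ≡-Reasoning)
open import Algebra.Properties.CommutativeSemigroup +-commutativeSemigroup
  using () renaming (x∙yz≈y∙xz to +-exchange)
open import Algebra.Properties.CommutativeSemigroup *-commutativeSemigroup
  using () renaming (x∙yz≈y∙xz to *-exchange)

private
  variable
    n : ℕ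

-- Written with `_≟_` as in Defs, so that `sumSqExcept j x` and `prodExcept j x` are
-- definitionally `sumF n ((λ i → x i * x i) [ j ]≔ 0)` and `prodF n (x [ j ]≔ 1)`.
_[_]≔_ : (Fin n → ℕ) → Fin n → ℕ → Fin n → ℕ
(f [ j ]≔ a) i = if ⌊ i ≟ j ⌋ then a else f i

[]≔-self : (f : Fin n → ℕ) (j : Fin n) (a : ℕ) → (f [ j ]≔ a) j ≡ a
[]≔-self f j a with j ≟ j
... | yes _  = refl
... | no j≢j = contradiction refl j≢j

[]≔-other : (f : Fin n → ℕ) {i j : Fin n} (a : ℕ) → i ≢ j → (f [ j ]≔ a) i ≡ f i
[]≔-other f {i} {j} a i≢j with i ≟ j
... | yes i≡j = contradiction i≡j i≢j
... | no _    = refl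

[]≔-preserves : (P : ℕ → Set) {f : Fin n → ℕ} {j : Fin n} {a : ℕ} →
                P a → (∀ i → P (f i)) → ∀ i → P ((f [ j ]≔ a) i)
[]≔-preserves P {j = j} Pa Pf i with ⌊ i ≟ j ⌋
... | true  = Pa
... | false = Pf i

[]≔-suc : (f : Fin (suc n) → ℕ) (j i : Fin n) (a : ℕ) →
          (f [ suc j ]≔ a) (suc i) ≡ ((λ k → f (suc k)) [ j ]≔ a) i
[]≔-suc f j i a with i ≟ j
... | yes _ = refl
... | no _  = refl

sumF-cong : ∀ n {f g : Fin n → ℕ} → (∀ i → f i ≡ g i) → sumF n f ≡ sumF n g
sumF-cong zero    f≗g = refl
sumF-cong (suc n) f≗g = cong₂ _+_ (f≗g zero) (sumF-cong n (λ i → f≗g (suc i)))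

prodF-cong : ∀ n {f g : Fin n → ℕ} → (∀ i → f i ≡ g i) → prodF n f ≡ prodF n g
prodF-cong zero    f≗g = refl
prodF-cong (suc n) f≗g = cong₂ _*_ (f≗g zero) (prodF-cong n (λ i → f≗g (suc i)))

sumF-mono-≤ : ∀ n {f g : Fin n → ℕ} → (∀ i → f i ≤ g i) → sumF n f ≤ sumF n g
sumF-mono-≤ zero    f≤g = z≤n
sumF-mono-≤ (suc n) f≤g = +-mono-≤ (f≤g zero) (sumF-mono-≤ n (λ i → f≤g (suc i)))

sumF-*ˡ : ∀ n (c : ℕ) (f : Fin n → ℕ) → sumF n (λ i → c * f i) ≡ c * sumF n f
sumF-*ˡ zero    c f = sym (*-zeroʳ c)
sumF-*ˡ (suc n) c f = begin
  c * f zero + sumF n (λ i → c * f (suc i)) ≡⟨ cong (c * f zero +_) (sumF-*ˡ n c (λ i → f (suc i))) ⟩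
  c * f zero + c * sumF n (λ i → f (suc i)) ≡⟨ *-distribˡ-+ c (f zero) _ ⟨
  c * sumF (suc n) f                        ∎
  where open ≡-Reasoning

sumF-*ʳ : ∀ n (c : ℕ) (f : Fin n → ℕ) → sumF n (λ i → f i * c) ≡ sumF n f * c
sumF-*ʳ n c f = begin
  sumF n (λ i → f i * c) ≡⟨ sumF-cong n (λ i → *-comm (f i) c) ⟩
  sumF n (λ i → c * f i) ≡⟨ sumF-*ˡ n c f ⟩
  c * sumF n f           ≡⟨ *-comm c _ ⟩
  sumF n f * c           ∎
  where open ≡-Reasoning

sumF-split : ∀ n (f : Fin n → ℕ) (j : Fin n) → sumF n f ≡ f j + sumF n (f [ j ]≔ 0)
sumF-split (suc n) f zero    = refl
sumF-split (suc n) f (suc j) = begin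
  f zero + sumF n (f ∘ suc)                        ≡⟨ cong (f zero +_) (sumF-split n (f ∘ suc) j) ⟩
  f zero + (f (suc j) + sumF n ((f ∘ suc) [ j ]≔ 0)) ≡⟨ +-exchange (f zero) (f (suc j)) _ ⟩
  f (suc j) + (f zero + sumF n ((f ∘ suc) [ j ]≔ 0)) ≡⟨ cong (λ s → f (suc j) + (f zero + s))
                                                          (sumF-cong n (λ i → sym ([]≔-suc f j i 0))) ⟩
  f (suc j) + sumF (suc n) (f [ suc j ]≔ 0)          ∎
  where open ≡-Reasoning

prodF-split : ∀ n (f : Fin n → ℕ) (j : Fin n) → prodF n f ≡ f j * prodF n (f [ j ]≔ 1)
prodF-split (suc n) f zero    = cong (f zero *_) (sym (*-identityˡ _))
prodF-split (suc n) f (suc j) = begin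
  f zero * prodF n (f ∘ suc)                        ≡⟨ cong (f zero *_) (prodF-split n (f ∘ suc) j) ⟩
  f zero * (f (suc j) * prodF n ((f ∘ suc) [ j ]≔ 1)) ≡⟨ *-exchange (f zero) (f (suc j)) _ ⟩
  f (suc j) * (f zero * prodF n ((f ∘ suc) [ j ]≔ 1)) ≡⟨ cong (λ p → f (suc j) * (f zero * p))
                                                           (prodF-cong n (λ i → sym ([]≔-suc f j i 1))) ⟩
  f (suc j) * prodF (suc n) (f [ suc j ]≔ 1)          ∎
  where open ≡-Reasoning

term≤sumF : ∀ n (f : Fin n → ℕ) (i : Fin n) → f i ≤ sumF n f
term≤sumF (suc n) f zero    = m≤m+n (f zero) _
term≤sumF (suc n) f (suc i) = m≤n⇒m≤o+n (f zero) (term≤sumF n (f ∘ suc) i)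

1≤prodF : ∀ n (f : Fin n → ℕ) → (∀ i → 1 ≤ f i) → 1 ≤ prodF n f
1≤prodF zero    f f≥1 = ≤-refl
1≤prodF (suc n) f f≥1 = *-mono-≤ (f≥1 zero) (1≤prodF n (f ∘ suc) (f≥1 ∘ suc))

factor≤prodF : ∀ n (f : Fin n → ℕ) → (∀ i → 1 ≤ f i) → ∀ i → f i ≤ prodF n f
factor≤prodF n f f≥1 i = begin
  f i                        ≤⟨ m≤m*n (f i) _ {{>-nonZero (1≤prodF n _ ([]≔-preserves (1 ≤_) ≤-refl f≥1))}} ⟩
  f i * prodF n (f [ i ]≔ 1) ≡⟨ prodF-split n f i ⟨
  prodF n f                  ∎
  where open ≤-Reasoning

prodExcept≤prodF : ∀ n (f : Fin n → ℕ) → (∀ i → 1 ≤ f i) → ∀ i → prodExcept i f ≤ prodF n f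
prodExcept≤prodF n f f≥1 i =
  subst (prodExcept i f ≤_) (sym (prodF-split n f i)) (m≤n*m _ (f i) {{>-nonZero (f≥1 i)}})

m+n≤1+m*n : ∀ {m n} → 1 ≤ m → 1 ≤ n → m + n ≤ 1 + m * n
m+n≤1+m*n {suc a} {suc b} _ _ = subst (suc a + suc b ≤_) (identity a b) (m≤m+n _ (a * b))
  where
  identity : ∀ a b → suc a + suc b + a * b ≡ 1 + suc a * suc b
  identity = solve-∀

sumF+1≤n+prodF : ∀ n (f : Fin n → ℕ) → (∀ i → 1 ≤ f i) → sumF n f + 1 ≤ n + prodF n f
sumF+1≤n+prodF zero    f f≥1 = ≤-refl
sumF+1≤n+prodF (suc n) f f≥1 = begin
  f zero + sumF n (f ∘ suc) + 1     ≡⟨ +-assoc (f zero) _ 1 ⟩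
  f zero + (sumF n (f ∘ suc) + 1)   ≤⟨ +-monoʳ-≤ (f zero) (sumF+1≤n+prodF n (f ∘ suc) (f≥1 ∘ suc)) ⟩
  f zero + (n + prodF n (f ∘ suc))  ≡⟨ +-exchange (f zero) n _ ⟩
  n + (f zero + prodF n (f ∘ suc))  ≤⟨ +-monoʳ-≤ n (m+n≤1+m*n (f≥1 zero) (1≤prodF n (f ∘ suc) (f≥1 ∘ suc))) ⟩
  n + (1 + f zero * prodF n (f ∘ suc)) ≡⟨ +-suc n _ ⟩
  suc n + prodF (suc n) f           ∎
  where open ≤-Reasoning

sumF-weighted-≤ : ∀ n (a b : Fin n → ℕ) (c : ℕ) (j : Fin n) → (∀ i → b i ≤ c) →
                  sumF n (λ i → a i * b i) + a j * c ≤ a j * b j + sumF n a * c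
sumF-weighted-≤ n a b c j b≤c = begin
  sumF n (λ i → a i * b i) + a j * c                                  ≡⟨ cong (_+ a j * c) (sumF-split n _ j) ⟩
  a j * b j + sumF n ((λ i → a i * b i) [ j ]≔ 0) + a j * c            ≤⟨ +-monoˡ-≤ (a j * c) (+-monoʳ-≤ (a j * b j) off-j) ⟩
  a j * b j + sumF n (a [ j ]≔ 0) * c + a j * c                       ≡⟨ regroup (a j * b j) _ (a j) c ⟩
  a j * b j + (a j + sumF n (a [ j ]≔ 0)) * c                         ≡⟨ cong (λ s → a j * b j + s * c) (sumF-split n a j) ⟨
  a j * b j + sumF n a * c                                            ∎
  where
  open ≤-Reasoning
  termwise : ∀ i → ((λ i → a i * b i) [ j ]≔ 0) i ≤ (a [ j ]≔ 0) i * c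
  termwise i with ⌊ i ≟ j ⌋
  ... | true  = z≤n
  ... | false = *-monoʳ-≤ (a i) (b≤c i)
  off-j : sumF n ((λ i → a i * b i) [ j ]≔ 0) ≤ sumF n (a [ j ]≔ 0) * c
  off-j = ≤-trans (sumF-mono-≤ n termwise) (≤-reflexive (sumF-*ʳ n c _))
  regroup : ∀ p s l c → p + s * c + l * c ≡ p + (l + s) * c
  regroup = solve-∀

m*m<n*n⇒m<n : ∀ {m n} → m * m < n * n → m < n
m*m<n*n⇒m<n {m} {n} mm<nn with n ≤? m
... | yes n≤m = contradiction (*-mono-≤ n≤m n≤m) (<⇒≱ mm<nn)
... | no n≰m  = ≰⇒> n≰m

-- m (C + t²) − t (m² + C) = (m − t) (C − m t)
t≤m∧mt≤C⇒t[m²+C]≤m[C+t²] : ∀ {t m C} → t ≤ m → m * t ≤ C → t * (m * m + C) ≤ m * (C + t * t)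
t≤m∧mt≤C⇒t[m²+C]≤m[C+t²] {t} t≤m mt≤C with m≤n⇒∃[o]m+o≡n t≤m
... | e , refl with m≤n⇒∃[o]m+o≡n mt≤C
...   | c , refl = subst (t * (m * m + C) ≤_) (identity t e c) (m≤m+n _ (e * c))
  where
  m = t + e
  C = m * t + c
  identity : ∀ t e c → t * ((t + e) * (t + e) + ((t + e) * t + c)) + e * c
                       ≡ (t + e) * (((t + e) * t + c) + t * t)
  identity = solve-∀

-- For f X = X² + C − B X the previous lemma says t · f m ≤ m · f t once m² ≤ C,
-- which is incompatible with f t < 0 ≤ f m.
mB≤m²+C∧C+t²<tB⇒C<m² : ∀ {t m B C} → 1 ≤ t → t ≤ m →
                        m * B ≤ m * m + C → C + t * t < t * B → C < m * m
mB≤m²+C∧C+t²<tB⇒C<m² {t} {m} {B} {C} 1≤t t≤m f[m]≥0 f[t]<0 with m * m ≤? C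
... | no m²≰C = ≰⇒> m²≰C
... | yes m²≤C = contradiction (begin-strict
      t * (m * B)     ≤⟨ *-monoʳ-≤ t f[m]≥0 ⟩
      t * (m * m + C) ≤⟨ t≤m∧mt≤C⇒t[m²+C]≤m[C+t²] t≤m (≤-trans (*-monoʳ-≤ m t≤m) m²≤C) ⟩
      m * (C + t * t) <⟨ *-monoʳ-< m {{>-nonZero (≤-trans 1≤t t≤m)}} f[t]<0 ⟩
      m * (t * B)     ≡⟨ *-exchange m t B ⟩
      t * (m * B)     ∎) (<-irrefl refl)
  where open ≤-Reasoning

-- X² − (C + 1) X + C = (X − 1) (X − C)
2≤m∧m[C+1]≤m²+C⇒C≤m : ∀ {m C} → 2 ≤ m → m * (C + 1) ≤ m * m + C → C ≤ m
2≤m∧m[C+1]≤m²+C⇒C≤m {suc (suc k)} {C} (s≤s (s≤s _)) f[m]≥0 =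
  *-cancelˡ-≤ (suc k) (+-cancelʳ-≤ (C + m) _ _ (subst₂ _≤_ (lhs k C) (rhs k C) f[m]≥0))
  where
  m = suc (suc k)
  lhs : ∀ k C → suc (suc k) * (C + 1) ≡ suc k * C + (C + suc (suc k))
  lhs = solve-∀
  rhs : ∀ k C → suc (suc k) * suc (suc k) + C ≡ suc k * suc (suc k) + (C + suc (suc k))
  rhs = solve-∀

n+Q+Q≤nQ+1 : ∀ {n Q} → 3 ≤ n → 2 ≤ Q → n + Q + Q ≤ n * Q + 1
n+Q+Q≤nQ+1 {n} {Q} 3≤n 2≤Q with m≤n⇒∃[o]m+o≡n 3≤n | m≤n⇒∃[o]m+o≡n 2≤Q
... | g , refl | h , refl = subst (n + Q + Q ≤_) (identity g h) (m≤m+n _ (h + g + g * h))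
  where
  identity : ∀ g h → (3 + g) + (2 + h) + (2 + h) + (h + g + g * h) ≡ (3 + g) * (2 + h) + 1
  identity = solve-∀

1+S+t≤t[n+Q]⇒S+lQ+t²<t[n+l]Q : ∀ {n Q S t} l → 3 ≤ n → 2 ≤ Q → 1 ≤ t → t ≤ Q →
                                1 + S + t ≤ t * (n + Q) → S + l * Q + t * t < t * ((n + l) * Q)
1+S+t≤t[n+Q]⇒S+lQ+t²<t[n+l]Q {n} {Q} {S} {t} l 3≤n 2≤Q 1≤t t≤Q bound =
  +-cancelʳ-≤ t _ _ (begin
    suc (S + l * Q + t * t) + t     ≡⟨ regroup S (l * Q) t ⟩
    (1 + S + t) + l * Q + t * t     ≤⟨ +-monoˡ-≤ (t * t) (+-mono-≤ bound (m≤n*m (l * Q) t {{>-nonZero 1≤t}})) ⟩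
    t * (n + Q) + t * (l * Q) + t * t ≡⟨ expand₁ t n Q (l * Q) ⟩
    t * (n + Q + t) + t * (l * Q)   ≤⟨ +-monoˡ-≤ (t * (l * Q)) (*-monoʳ-≤ t n+Q+t≤nQ+1) ⟩
    t * (n * Q + 1) + t * (l * Q)   ≡⟨ expand₂ t n Q l ⟩
    t * ((n + l) * Q) + t           ∎)
  where
  open ≤-Reasoning
  n+Q+t≤nQ+1 : n + Q + t ≤ n * Q + 1
  n+Q+t≤nQ+1 = ≤-trans (+-monoʳ-≤ (n + Q) t≤Q) (n+Q+Q≤nQ+1 3≤n 2≤Q)
  regroup : ∀ S p t → suc (S + p + t * t) + t ≡ (1 + S + t) + p + t * t
  regroup = solve-∀
  expand₁ : ∀ t n Q p → t * (n + Q) + t * p + t * t ≡ t * (n + Q + t) + t * p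
  expand₁ = solve-∀
  expand₂ : ∀ t n Q l → t * (n * Q + 1) + t * (l * Q) ≡ t * ((n + l) * Q) + t
  expand₂ = solve-∀

1+S+Q≤Q[n+Q]⇒S+lQ+1≤[n+l]Q : ∀ {n Q S} l → Q ≡ 1 →
                               1 + S + Q ≤ Q * (n + Q) → S + l * Q + 1 ≤ (n + l) * Q
1+S+Q≤Q[n+Q]⇒S+lQ+1≤[n+l]Q {n} {S = S} l refl bound = +-cancelʳ-≤ 1 _ _ (begin
  S + l * 1 + 1 + 1 ≡⟨ regroup S l ⟩
  1 + S + 1 + l     ≤⟨ +-monoˡ-≤ l bound ⟩
  1 * (n + 1) + l   ≡⟨ regroup′ n l ⟩
  (n + l) * 1 + 1   ∎)
  where
  open ≤-Reasoning
  regroup : ∀ S l → S + l * 1 + 1 + 1 ≡ 1 + S + 1 + l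
  regroup = solve-∀
  regroup′ : ∀ n l → 1 * (n + 1) + l ≡ (n + l) * 1 + 1
  regroup′ = solve-∀

2≤max : ∀ {n} (x : Fin n → ℕ) (j : Fin n) → (∀ i → 1 ≤ x i) → (∀ i → x i ≤ x j) →
        ¬ (∀ i → x i ≡ 1) → 2 ≤ x j
2≤max x j x≥1 x≤xj x≢1 with 2 ≤? x j
... | yes 2≤xj = 2≤xj
... | no 2≰xj  = contradiction (λ i → ≤-antisym (≤-trans (x≤xj i) (s≤s⁻¹ (≰⇒> 2≰xj))) (x≥1 i)) x≢1

module _ {n : ℕ} (lam x : Fin n → ℕ) (j : Fin n) (x≥1 : ∀ i → 1 ≤ x i) where
  private
    m = x j
    Q = prodExcept j x
    S = sumSqExcept j x
    x[j]≔1≥1 : ∀ i → 1 ≤ (x [ j ]≔ 1) i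
    x[j]≔1≥1 = []≔-preserves (1 ≤_) ≤-refl x≥1

  -- Each term λ_i ∏_{k≠i} x_k of the equation is at most λ_i m Q, except the
  -- j-th, which is λ_j Q.
  solution⇒mB≤m²+C : IsSolution n lam x → m * ((n + lam j) * Q) ≤ m * m + (S + lam j * Q)
  solution⇒mB≤m²+C sol = +-cancelʳ-≤ (L * (m * Q)) _ _ (begin
    m * ((n + lam j) * Q) + L * (m * Q)   ≡⟨ regroup₁ m n (lam j) Q L ⟩
    (n + L) * (m * Q) + lam j * (m * Q)   ≡⟨ cong (_+ lam j * (m * Q)) sol′ ⟨
    m * m + S + T + lam j * (m * Q)       ≡⟨ +-assoc (m * m + S) T _ ⟩
    m * m + S + (T + lam j * (m * Q))     ≤⟨ +-monoʳ-≤ (m * m + S) T-bound ⟩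
    m * m + S + (lam j * Q + L * (m * Q)) ≡⟨ regroup₂ (m * m) S (lam j * Q) _ ⟩
    m * m + (S + lam j * Q) + L * (m * Q) ∎)
    where
    open ≤-Reasoning
    T = sumF n (λ i → lam i * prodExcept i x)
    L = sumF n lam
    sol′ : m * m + S + T ≡ (n + L) * (m * Q)
    sol′ = subst₂ (λ s p → s + T ≡ (n + L) * p)
                  (sumF-split n (λ i → x i * x i) j) (prodF-split n x j) sol
    T-bound : T + lam j * (m * Q) ≤ lam j * Q + L * (m * Q)
    T-bound = subst (λ p → T + lam j * p ≤ lam j * Q + L * p) (prodF-split n x j)
                (sumF-weighted-≤ n lam (λ i → prodExcept i x) (prodF n x) j (prodExcept≤prodF n x x≥1))
    regroup₁ : ∀ m n l Q L → m * ((n + l) * Q) + L * (m * Q) ≡ (n + L) * (m * Q) + l * (m * Q)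
    regroup₁ = solve-∀
    regroup₂ : ∀ a S p q → a + S + (p + q) ≡ a + (S + p) + q
    regroup₂ = solve-∀

  -- Σ z² ≤ t Σ z ≤ t (n − 1 + Q) for z = x [ j ]≔ 1, whose squares sum to 1 + S
  -- and whose product is Q.
  1+S+t≤t[n+Q] : ∀ t → (∀ i → (x [ j ]≔ 1) i ≤ t) → 1 + S + t ≤ t * (n + Q)
  1+S+t≤t[n+Q] t z≤t = begin
    1 + S + t                            ≡⟨ cong (_+ t) sumF-z² ⟨
    sumF n (λ i → z i * z i) + t         ≤⟨ +-monoˡ-≤ t (sumF-mono-≤ n (λ i → *-monoˡ-≤ (z i) (z≤t i))) ⟩
    sumF n (λ i → t * z i) + t           ≡⟨ cong (_+ t) (sumF-*ˡ n t z) ⟩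
    t * sumF n z + t                     ≡⟨ cong (t * sumF n z +_) (*-identityʳ t) ⟨
    t * sumF n z + t * 1                 ≡⟨ *-distribˡ-+ t _ 1 ⟨
    t * (sumF n z + 1)                   ≤⟨ *-monoʳ-≤ t (sumF+1≤n+prodF n z x[j]≔1≥1) ⟩
    t * (n + Q)                          ∎
    where
    open ≤-Reasoning
    z = x [ j ]≔ 1
    sumF-z² : sumF n (λ i → z i * z i) ≡ 1 + S
    sumF-z² = begin-equality
      sumF n (λ i → z i * z i)                            ≡⟨ sumF-split n _ j ⟩
      z j * z j + sumF n ((λ i → z i * z i) [ j ]≔ 0)     ≡⟨ cong₂ _+_ (cong₂ _*_ ([]≔-self x j 1) ([]≔-self x j 1))
                                                                        (sumF-cong n off-j) ⟩
      1 + S                                              ∎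
      where
      off-j : ∀ i → ((λ i → z i * z i) [ j ]≔ 0) i ≡ ((λ i → x i * x i) [ j ]≔ 0) i
      off-j i with ⌊ i ≟ j ⌋
      ... | true  = refl
      ... | false = refl

  S+λQ<m² : 3 ≤ n → ¬ (∀ i → x i ≡ 1) → IsSolution n lam x → (∀ i → x i ≤ x j) →
            S + lam j * Q < m * m
  S+λQ<m² 3≤n x≢1 sol x≤m with Q ≤? 1
  ... | yes Q≤1 = ≤-<-trans C≤m (m<m*n m m {{>-nonZero (<⇒≤ 2≤m)}} 2≤m)
    where
    2≤m : 2 ≤ m
    2≤m = 2≤max x j x≥1 x≤m x≢1
    Q≡1 : Q ≡ 1
    Q≡1 = ≤-antisym Q≤1 (1≤prodF n _ x[j]≔1≥1)
    C+1≤B : S + lam j * Q + 1 ≤ (n + lam j) * Q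
    C+1≤B = 1+S+Q≤Q[n+Q]⇒S+lQ+1≤[n+l]Q (lam j) Q≡1 (1+S+t≤t[n+Q] Q (factor≤prodF n _ x[j]≔1≥1))
    C≤m : S + lam j * Q ≤ m
    C≤m = 2≤m∧m[C+1]≤m²+C⇒C≤m 2≤m (≤-trans (*-monoʳ-≤ m C+1≤B) (solution⇒mB≤m²+C sol))
  ... | no Q≰1 = mB≤m²+C∧C+t²<tB⇒C<m² 1≤t (m⊓n≤m m Q) (solution⇒mB≤m²+C sol)
                   (1+S+t≤t[n+Q]⇒S+lQ+t²<t[n+l]Q (lam j) 3≤n (≰⇒> Q≰1) 1≤t (m⊓n≤n m Q)
                     (1+S+t≤t[n+Q] t (λ i → ⊓-glb (z≤m i) (factor≤prodF n _ x[j]≔1≥1 i))))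
    where
    t = m ⊓ Q
    1≤t : 1 ≤ t
    1≤t = ⊓-glb (x≥1 j) (1≤prodF n _ x[j]≔1≥1)
    z≤m : ∀ i → (x [ j ]≔ 1) i ≤ m
    z≤m = []≔-preserves (_≤ m) (x≥1 j) x≤m

lemma2p3 : (n : ℕ) → 3 ≤ n → (lam : Fin n → ℕ) → (x : Fin n → ℕ) →
  (pos : ∀ i → 1 ≤ x i) →
  ¬ (∀ i → x i ≡ 1) →
  IsSolution n lam x →
  (j : Fin n) → (∀ i → x i ≤ x j) →
  ∀ i → mutate lam j x {{>-nonZero (pos j)}} i < x j
lemma2p3 n 3≤n lam x pos x≢1 sol j x≤xj = entry<xj
  where
  C<xj² : sumSqExcept j x + lam j * prodExcept j x < x j * x j
  C<xj² = S+λQ<m² lam x j pos 3≤n x≢1 sol x≤xj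
  entry<xj : ∀ i → mutate lam j x {{>-nonZero (pos j)}} i < x j
  entry<xj i with i ≟ j
  ... | yes refl = m<n*o⇒m/o<n {{>-nonZero (pos j)}} C<xj²
  ... | no i≢j   = m*m<n*n⇒m<n (≤-<-trans xi²≤C C<xj²)
    where
    xi²≤C : x i * x i ≤ sumSqExcept j x + lam j * prodExcept j x
    xi²≤C = ≤-trans (subst (_≤ sumSqExcept j x) ([]≔-other (λ k → x k * x k) 0 i≢j) (term≤sumF n _ i))
                    (m≤m+n _ _)
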